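{- Let $n$ be an odd positive integer, and for each prime $p\mid n$ let $p^{r_p}$ be the exact power of $p$ dividing $n$. If for every prime factor $p$ of $n$, $p-1$ does not divide $n/p^{r_p}-1$, then $n\in\mathfrak{P}$.
   Context: For an odd positive integer $n$, put $G(n)=\sum_{j=1}^{n-1} j^{(n-1)/2}$. Let $\mathfrak{P}$ denote the set of odd positive integers $n$ such that $G(n)\equiv 0\pmod n$. -}

module Defs where

open import Data.Nat using (ℕ; suc; _+_; _*_; _∸_; _^_; _/_)
open import Data.Nat.Divisibility using (_∣_)
open import Data.Nat.ListAction using (sum)
open import Data.List using (map; upTo)
open import Data.Product using (Σ; _×_)
open import Relation.Binary.PropositionalEquality using (_≡_)

Odd : ℕ → Set
Odd n = Σ ℕ (λ k → n ≡ suc (2 * k))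

-- G(n) = Σ_{j=1}^{n-1} j^((n-1)/2)
-- upTo (n ∸ 1) = [0, …, n-2], so suc j ranges exactly over 1, …, n-1.
G : ℕ → ℕ
G n = sum (map (λ j → suc j ^ ((n ∸ 1) / 2)) (upTo (n ∸ 1)))

InP : ℕ → Set
InP n = Odd n × (n ∣ G n)

module Submission where

-- Write n = 2e + 1.  For e ≥ 1, G(n) is the power sum S = Σ_{i<n} i^e, and we show
-- q^r ∣ S for every prime q with n = q^r·m, q ∤ m; since distinct prime-power parts
-- of n are coprime, this gives n ∣ S (local-to-global).
--
-- Modulo q - 1 we have q ≡ 1, so n ≡ m; hence (q - 1) ∤ (m - 1) forces
-- (q - 1) ∤ 2e and in particular (q - 1) ∤ e.  Then some unit g modulo q has
-- g^e ≢ 1 (mod q): otherwise, reducing e modulo q - 1 by Fermat's little theorem, a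
-- power sum Σ_{i<q} i^d with 0 < d < q - 1 would be ≡ q - 1, whereas such sums vanish
-- modulo q by the binomial recurrence.  Lift g to a unit a modulo n with a ≡ g
-- (mod q).  Multiplication by a permutes the residues modulo n, so a^e·S ≡ S (mod n),
-- i.e. n ∣ (a^e - 1)·S, and q ∤ a^e - 1 leaves q^r ∣ S.

open import Defs
open import Data.Nat
open import Data.Nat.Properties
open import Data.Nat.DivMod
open import Data.Nat.Divisibility
import Data.Nat.Coprimality as Coprimality
open Coprimality using (Coprime; coprime-divisor; coprime-Bézout; coprime⇒gcd≡1)
open import Data.Nat.GCD using (module Bézout)
open import Data.Nat.LCM using (lcm; lcm-least; gcd*lcm)
open import Data.Nat.Primality using (Prime; prime⇒irreducible; euclidsLemma)
open import Data.Nat.Primality.Factorisation using (factorise)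
open import Data.Nat.Combinatorics using (_C_; nC1≡n)
open import Data.Nat.Induction using (<-rec)
open import Data.Nat.ListAction using (sum; product)
open import Data.Nat.Solver using (module +-*-Solver)
open +-*-Solver
open import Data.Fin using (Fin; zero; suc; toℕ; fromℕ<)
open import Data.Fin.Properties using (toℕ<n; toℕ-fromℕ<; toℕ-injective)
open import Data.Fin.Permutation as Perm using (Permutation)
open import Data.List using (_∷_; []; map; applyUpTo; upTo)
open import Data.List.Relation.Unary.All using (_∷_)
open import Data.Product using (_×_; _,_; ∃; ∃₂; proj₁; proj₂)
open import Data.Sum using (inj₁; inj₂; [_,_]′)
open import Function using (_∘_; id)
open import Level using (0ℓ)
open import Algebra.Bundles using (Semiring)
import Algebra.Definitions.RawSemiring as RawSemiringDefinitions
import Algebra.Properties.Semiring.Sum as SemiringSum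
import Algebra.Properties.CommutativeMonoid.Sum as MonoidSum
import Algebra.Properties.Semiring.Binomial as BinomialTheorem
open import Relation.Nullary using (¬_; ¬?; yes; no; contradiction)
open import Relation.Nullary.Decidable using (_×-dec_; decidable-stable)
open import Relation.Binary using (Setoid; IsEquivalence)
import Relation.Binary.Reasoning.Setoid as SetoidReasoning
open import Relation.Binary.PropositionalEquality

private variable m : ℕ

module Sum = SemiringSum +-*-semiring
module Product = MonoidSum *-1-commutativeMonoid

∑ : (Fin m → ℕ) → ℕ
∑ = Sum.sum

∏ : (Fin m → ℕ) → ℕ
∏ = Product.sum

powerSum : ℕ → ℕ → ℕ
powerSum N k = ∑ {N} (λ i → toℕ i ^ k)

∑-∣ : ∀ {d} (f : Fin m → ℕ) → (∀ i → d ∣ f i) → d ∣ ∑ f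
∑-∣ {zero}  f d∣f = divides 0 refl
∑-∣ {suc m} f d∣f = ∣m∣n⇒∣m+n (d∣f zero) (∑-∣ (f ∘ suc) (d∣f ∘ suc))

∏-scale : ∀ x (f : Fin m → ℕ) → ∏ (λ i → x * f i) ≡ x ^ m * ∏ f
∏-scale {zero}  x f = refl
∏-scale {suc m} x f = trans (cong (x * f zero *_) (∏-scale x (f ∘ suc)))
  (solve 4 (λ x y z w → x :* y :* (z :* w) := x :* z :* (y :* w)) refl x (f zero) (x ^ m) (∏ (f ∘ suc)))

^-distribʳ-* : ∀ a b e → (a * b) ^ e ≡ a ^ e * b ^ e
^-distribʳ-* a b zero    = refl
^-distribʳ-* a b (suc e) = trans (cong (a * b *_) (^-distribʳ-* a b e))
  (solve 4 (λ a b x y → a :* b :* (x :* y) := a :* x :* (b :* y)) refl a b (a ^ e) (b ^ e))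

module ℕ-Semiring = RawSemiringDefinitions (Semiring.rawSemiring +-*-semiring)

^ₛ≡^ : ∀ x n → x ℕ-Semiring.^ n ≡ x ^ n
^ₛ≡^ x zero    = refl
^ₛ≡^ x (suc n) = cong (x *_) (^ₛ≡^ x n)

×ₛ≡* : ∀ n y → n ℕ-Semiring.× y ≡ n * y
×ₛ≡* zero    y = refl
×ₛ≡* (suc n) y = cong (y +_) (×ₛ≡* n y)

∑-ones : ∀ m → ∑ {m} (λ _ → 1) ≡ m
∑-ones m = trans (Sum.sum-replicate m) (trans (×ₛ≡* m 1) (*-identityʳ m))

∑-last : ∀ m (f : ℕ → ℕ) → ∑ {suc m} (λ i → f (toℕ i)) ≡ ∑ {m} (λ i → f (toℕ i)) + f m
∑-last zero    f = +-comm (f 0) 0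
∑-last (suc m) f = trans (cong (f 0 +_) (∑-last m (f ∘ suc))) (sym (+-assoc (f 0) _ _))

binomial : ∀ x J → suc x ^ J ≡ ∑ {suc J} (λ k → (J C toℕ k) * x ^ (J ∸ toℕ k))
binomial x J = begin
  suc x ^ J                                         ≡⟨ ^ₛ≡^ (suc x) J ⟨
  suc x ℕ-Semiring.^ J                              ≡⟨ Binomial.theorem (*-comm 1 x) J ⟩
  Binomial.binomialExpansion J                      ≡⟨ Sum.sum-cong-≗ {suc J} term ⟩
  ∑ {suc J} (λ k → (J C toℕ k) * x ^ (J ∸ toℕ k))  ∎
  where
  open ≡-Reasoning
  module Binomial = BinomialTheorem +-*-semiring 1 x
  term : ∀ k → Binomial.binomialTerm J k ≡ (J C toℕ k) * x ^ (J ∸ toℕ k)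
  term k = begin
    Binomial.binomialTerm J k
      ≡⟨ ×ₛ≡* (J C toℕ k) _ ⟩
    (J C toℕ k) * (1 ℕ-Semiring.^ toℕ k * x ℕ-Semiring.^ (J ∸ toℕ k))
      ≡⟨ cong ((J C toℕ k) *_) (cong₂ _*_ (trans (^ₛ≡^ 1 (toℕ k)) (^-zeroˡ (toℕ k))) (^ₛ≡^ x (J ∸ toℕ k))) ⟩
    (J C toℕ k) * (1 * x ^ (J ∸ toℕ k))
      ≡⟨ cong ((J C toℕ k) *_) (*-identityˡ _) ⟩
    (J C toℕ k) * x ^ (J ∸ toℕ k)  ∎

-- Summing (i + 1)^(J+1) over i < N in two ways: as a shifted power sum, and term
-- by term with the binomial theorem.
powerSum-recurrence : ∀ N J → powerSum N (suc J) + N ^ suc J ≡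
                      ∑ {suc (suc J)} (λ k → (suc J C toℕ k) * powerSum N (suc J ∸ toℕ k))
powerSum-recurrence N J = begin
  powerSum N (suc J) + N ^ suc J
    ≡⟨ ∑-last N (_^ suc J) ⟨
  ∑ {N} (λ i → suc (toℕ i) ^ suc J)
    ≡⟨ Sum.sum-cong-≗ {N} (λ i → binomial (toℕ i) (suc J)) ⟩
  ∑ {N} (λ i → ∑ {suc (suc J)} (λ k → (suc J C toℕ k) * toℕ i ^ (suc J ∸ toℕ k)))
    ≡⟨ Sum.∑-comm {N} {suc (suc J)} (λ i k → (suc J C toℕ k) * toℕ i ^ (suc J ∸ toℕ k)) ⟩
  ∑ {suc (suc J)} (λ k → ∑ {N} (λ i → (suc J C toℕ k) * toℕ i ^ (suc J ∸ toℕ k)))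
    ≡⟨ Sum.sum-cong-≗ {suc (suc J)} (λ k → Sum.*-distribˡ-sum {N} (suc J C toℕ k) (λ i → toℕ i ^ (suc J ∸ toℕ k))) ⟨
  ∑ {suc (suc J)} (λ k → (suc J C toℕ k) * powerSum N (suc J ∸ toℕ k))  ∎
  where open ≡-Reasoning

∸suc< : ∀ {j} (k : Fin j) → j ∸ suc (toℕ k) < j
∸suc< {suc j} k = s≤s (m∸n≤m j (toℕ k))

module Mod (N : ℕ) .{{_ : NonZero N}} where

  infix 4 _≈_
  record _≈_ (a b : ℕ) : Set where
    constructor %≡⇒≈
    field ≈⇒%≡ : a % N ≡ b % N
  open _≈_ public

  ≈-isEquivalence : IsEquivalence _≈_
  ≈-isEquivalence = record
    { refl  = %≡⇒≈ refl
    ; sym   = λ a≈b → %≡⇒≈ (sym (≈⇒%≡ a≈b))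
    ; trans = λ a≈b b≈c → %≡⇒≈ (trans (≈⇒%≡ a≈b) (≈⇒%≡ b≈c))
    }

  open IsEquivalence ≈-isEquivalence public
    using () renaming (refl to ≈-refl; sym to ≈-sym; trans to ≈-trans; reflexive to ≈-reflexive)

  ≈-setoid : Setoid 0ℓ 0ℓ
  ≈-setoid = record { isEquivalence = ≈-isEquivalence }

  module ≈-Reasoning = SetoidReasoning ≈-setoid

  %-≈ : ∀ a → a % N ≈ a
  %-≈ a = %≡⇒≈ (m%n%n≡m%n a N)

  ≈-+ : ∀ {a a′ b b′} → a ≈ a′ → b ≈ b′ → a + b ≈ a′ + b′
  ≈-+ {a} {a′} {b} {b′} (%≡⇒≈ a≡) (%≡⇒≈ b≡) = %≡⇒≈ (begin
    (a + b) % N             ≡⟨ %-distribˡ-+ a b N ⟩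
    (a % N + b % N) % N     ≡⟨ cong₂ (λ x y → (x + y) % N) a≡ b≡ ⟩
    (a′ % N + b′ % N) % N   ≡⟨ %-distribˡ-+ a′ b′ N ⟨
    (a′ + b′) % N           ∎)
    where open ≡-Reasoning

  ≈-* : ∀ {a a′ b b′} → a ≈ a′ → b ≈ b′ → a * b ≈ a′ * b′
  ≈-* {a} {a′} {b} {b′} (%≡⇒≈ a≡) (%≡⇒≈ b≡) = %≡⇒≈ (begin
    (a * b) % N               ≡⟨ %-distribˡ-* a b N ⟩
    (a % N * (b % N)) % N     ≡⟨ cong₂ (λ x y → (x * y) % N) a≡ b≡ ⟩
    (a′ % N * (b′ % N)) % N   ≡⟨ %-distribˡ-* a′ b′ N ⟨
    (a′ * b′) % N             ∎)
    where open ≡-Reasoning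

  ≈-^ : ∀ {a a′} k → a ≈ a′ → a ^ k ≈ a′ ^ k
  ≈-^ zero    a≈a′ = ≈-refl
  ≈-^ (suc k) a≈a′ = ≈-* a≈a′ (≈-^ k a≈a′)

  ∑-≈ : {f g : Fin m → ℕ} → (∀ i → f i ≈ g i) → ∑ f ≈ ∑ g
  ∑-≈ {zero}  f≈g = ≈-refl
  ∑-≈ {suc m} f≈g = ≈-+ (f≈g zero) (∑-≈ (f≈g ∘ suc))

  ∏-≈ : {f g : Fin m → ℕ} → (∀ i → f i ≈ g i) → ∏ f ≈ ∏ g
  ∏-≈ {zero}  f≈g = ≈-refl
  ∏-≈ {suc m} f≈g = ≈-* (f≈g zero) (∏-≈ (f≈g ∘ suc))

  ≈⇒∣∸ : ∀ {a b} → b ≤ a → a ≈ b → N ∣ a ∸ b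
  ≈⇒∣∸ {a} {b} b≤a (%≡⇒≈ a≡b) = divides (a / N ∸ b / N) (begin
    a ∸ b                                     ≡⟨ cong₂ _∸_ (m≡m%n+[m/n]*n a N) (m≡m%n+[m/n]*n b N) ⟩
    (a % N + a / N * N) ∸ (b % N + b / N * N) ≡⟨ cong (λ x → (x + a / N * N) ∸ (b % N + b / N * N)) a≡b ⟩
    (b % N + a / N * N) ∸ (b % N + b / N * N) ≡⟨ [m+n]∸[m+o]≡n∸o (b % N) (a / N * N) (b / N * N) ⟩
    a / N * N ∸ b / N * N                     ≡⟨ *-distribʳ-∸ N (a / N) (b / N) ⟨
    (a / N ∸ b / N) * N                       ∎)
    where open ≡-Reasoning

  ≈0⇒∣ : ∀ {a} → a ≈ 0 → N ∣ a
  ≈0⇒∣ = ≈⇒∣∸ z≤n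

  ∣⇒≈0 : ∀ {a} → N ∣ a → a ≈ 0
  ∣⇒≈0 {a} N∣a = %≡⇒≈ (trans (cong (_% N) (sym (+-identityʳ a))) (%-remove-+ˡ 0 N∣a))

  ∣∸1⇒≈1 : ∀ {b} → 1 ≤ b → N ∣ b ∸ 1 → b ≈ 1
  ∣∸1⇒≈1 {suc b} _ N∣b = %≡⇒≈ (trans (cong (_% N) (+-comm 1 b)) (%-remove-+ˡ 1 N∣b))

  fixed⇒∣ : ∀ A T → 1 ≤ A → A * T ≈ T → N ∣ (A ∸ 1) * T
  fixed⇒∣ A T 1≤A AT≈T = subst (N ∣_) AT∸T≡ (≈⇒∣∸ (m≤n*m T A {{>-nonZero 1≤A}}) AT≈T)
    where
    AT∸T≡ : A * T ∸ T ≡ (A ∸ 1) * T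
    AT∸T≡ = trans (cong (A * T ∸_) (sym (*-identityˡ T))) (sym (*-distribʳ-∸ T A 1))

prime>1 : ∀ {p} → Prime p → 1 < p
prime>1 {suc (suc _)} _ = s≤s (s≤s z≤n)

¬∣-small : ∀ {p j} → 0 < j → j < p → ¬ p ∣ j
¬∣-small {j = suc _} _ j<p p∣j = <⇒≱ j<p (∣⇒≤ p∣j)

¬∣-* : ∀ {p a b} → Prime p → ¬ p ∣ a → ¬ p ∣ b → ¬ p ∣ a * b
¬∣-* {a = a} {b} pp p∤a p∤b p∣ab = [ p∤a , p∤b ]′ (euclidsLemma a b pp p∣ab)

∏-¬∣ : ∀ {p} → Prime p → (f : Fin m → ℕ) → (∀ i → ¬ p ∣ f i) → ¬ p ∣ ∏ f
∏-¬∣ {zero}  pp f _   = ¬∣-small (s≤s z≤n) (prime>1 pp)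
∏-¬∣ {suc m} pp f p∤f = ¬∣-* pp (p∤f zero) (∏-¬∣ pp (f ∘ suc) (p∤f ∘ suc))

prime⇒coprime-¬∣ : ∀ {p x} → Prime p → ¬ p ∣ x → Coprime p x
prime⇒coprime-¬∣ pp p∤x (d∣p , d∣x) with prime⇒irreducible pp d∣p
... | inj₁ d≡1  = d≡1
... | inj₂ refl = contradiction d∣x p∤x

coprime-* : ∀ {y z x} → Coprime y x → Coprime z x → Coprime (y * z) x
coprime-* {y} {z} {x} y⊥x z⊥x {i} (i∣yz , i∣x) = z⊥x (coprime-divisor i⊥y i∣yz , i∣x)
  where
  i⊥y : Coprime i y
  i⊥y (j∣i , j∣y) = y⊥x (j∣y , ∣-trans j∣i i∣x)

coprime-^ : ∀ {y x} r → Coprime y x → Coprime (y ^ r) x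
coprime-^ zero    y⊥x (i∣1 , _) = ∣1⇒≡1 i∣1
coprime-^ (suc r) y⊥x = coprime-* y⊥x (coprime-^ r y⊥x)

primePower-cancel : ∀ {p x T} r → Prime p → ¬ p ∣ x → p ^ r ∣ x * T → p ^ r ∣ T
primePower-cancel r pp p∤x = coprime-divisor (coprime-^ r (prime⇒coprime-¬∣ pp p∤x))

coprime-∣-* : ∀ {a b T} → Coprime a b → a ∣ T → b ∣ T → a * b ∣ T
coprime-∣-* {a} {b} a⊥b a∣T b∣T = subst (_∣ _) lcm≡ab (lcm-least a∣T b∣T)
  where
  lcm≡ab : lcm a b ≡ a * b
  lcm≡ab = trans (sym (*-identityˡ (lcm a b)))
                 (trans (cong (_* lcm a b) (sym (coprime⇒gcd≡1 a⊥b))) (gcd*lcm a b))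

exactPower : ∀ p → 1 < p → ∀ N → .{{NonZero N}} → ∃₂ λ s M → N ≡ p ^ s * M × ¬ p ∣ M
exactPower p 1<p = <-rec Split split
  where
  Split : ℕ → Set
  Split N = .{{NonZero N}} → ∃₂ λ s M → N ≡ p ^ s * M × ¬ p ∣ M
  split : ∀ N → (∀ {y} → y < N → Split y) → Split N
  split N rec with p ∣? N
  ... | no p∤N = 0 , N , sym (+-identityʳ N) , p∤N
  ... | yes (divides (suc q) refl) with rec {suc q} (m<m*n (suc q) p 1<p)
  ...   | s , M , q≡ , p∤M = suc s , M , N≡ , p∤M
    where
    N≡ : suc q * p ≡ p * p ^ s * M
    N≡ = trans (*-comm (suc q) p) (trans (cong (p *_) q≡) (sym (*-assoc p (p ^ s) M)))

modularInverse : ∀ {c N} .{{_ : NonZero N}} → Coprime c N → ∃ λ u → Mod._≈_ N (c * u) 1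
modularInverse {c} {N} c⊥N with coprime-Bézout c⊥N
... | Bézout.+- x y 1+yN≡xc = x , %≡⇒≈ (begin
    (c * x) % N       ≡⟨ cong (_% N) (trans (*-comm c x) (sym 1+yN≡xc)) ⟩
    (1 + y * N) % N   ≡⟨ %-remove-+ʳ 1 (n∣m*n y) ⟩
    1 % N             ∎)
  where
  open Mod N
  open ≡-Reasoning
modularInverse {c} {N@(suc N′)} c⊥N | Bézout.-+ x y 1+xc≡yN = x * N′ , %≡⇒≈ (begin
    c * (x * N′) % N                  ≡⟨ %-remove-+ʳ (c * (x * N′)) (divides y 1+xc≡yN) ⟨
    (c * (x * N′) + (1 + x * c)) % N  ≡⟨ cong (_% N) rearrange ⟩
    (1 + x * c * N) % N               ≡⟨ %-remove-+ʳ 1 (n∣m*n (x * c)) ⟩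
    1 % N                             ∎)
  where
  open Mod N
  open ≡-Reasoning
  rearrange : c * (x * N′) + (1 + x * c) ≡ 1 + x * c * N
  rearrange = solve 3 (λ c x N′ → c :* (x :* N′) :+ (con 1 :+ x :* c)
                                 := con 1 :+ x :* c :* (con 1 :+ N′)) refl c x N′

scale : (N : ℕ) .{{_ : NonZero N}} → ℕ → Fin N → Fin N
scale N c i = fromℕ< (m%n<n (c * toℕ i) N)

module _ (N : ℕ) .{{_ : NonZero N}} where
  open Mod N

  toℕ-scale : ∀ c i → toℕ (scale N c i) ≡ (c * toℕ i) % N
  toℕ-scale c i = toℕ-fromℕ< (m%n<n (c * toℕ i) N)

  scale-inverse : ∀ c d → d * c ≈ 1 → ∀ i → scale N d (scale N c i) ≡ i
  scale-inverse c d dc≈1 i = toℕ-injective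
    (trans (toℕ-scale d (scale N c i)) (trans (≈⇒%≡ d·cx≈x) (m<n⇒m%n≡m (toℕ<n i))))
    where
    open ≈-Reasoning
    x : ℕ
    x = toℕ i
    d·cx≈x : d * toℕ (scale N c i) ≈ x
    d·cx≈x = begin
      d * toℕ (scale N c i)  ≡⟨ cong (d *_) (toℕ-scale c i) ⟩
      d * ((c * x) % N)      ≈⟨ ≈-* (≈-refl {d}) (%-≈ (c * x)) ⟩
      d * (c * x)            ≡⟨ *-assoc d c x ⟨
      d * c * x              ≈⟨ ≈-* dc≈1 (≈-refl {x}) ⟩
      1 * x                  ≡⟨ *-identityˡ x ⟩
      x                      ∎

  unitPermutation : ∀ a b → a * b ≈ 1 → Permutation N N
  unitPermutation a b ab≈1 = Perm.permutation (scale N a) (scale N b)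
    (scale-inverse b a ab≈1)
    (scale-inverse a b (≈-trans (%≡⇒≈ (cong (_% N) (*-comm b a))) ab≈1))

  -- Reindexing S = Σ_{i<N} i^e along i ↦ a·i shows a^e·S ≡ S (mod N),
  -- so N ∣ (a^e - 1)·S.
  powerSum-unit : ∀ a b .{{_ : NonZero a}} → a * b ≈ 1 → ∀ e → N ∣ (a ^ e ∸ 1) * powerSum N e
  powerSum-unit a b ab≈1 e = fixed⇒∣ (a ^ e) S (m^n>0 a e) (≈-sym S≈a^eS)
    where
    open ≈-Reasoning
    S : ℕ
    S = powerSum N e
    scaled : ∀ i → toℕ (scale N a i) ^ e ≈ a ^ e * toℕ i ^ e
    scaled i = begin
      toℕ (scale N a i) ^ e   ≡⟨ cong (_^ e) (toℕ-scale a i) ⟩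
      ((a * toℕ i) % N) ^ e   ≈⟨ ≈-^ e (%-≈ (a * toℕ i)) ⟩
      (a * toℕ i) ^ e         ≡⟨ ^-distribʳ-* a (toℕ i) e ⟩
      a ^ e * toℕ i ^ e       ∎
    S≈a^eS : S ≈ a ^ e * S
    S≈a^eS = begin
      S                                     ≡⟨ Sum.sum-permute {N} {N} (λ i → toℕ i ^ e) (unitPermutation a b ab≈1) ⟩
      ∑ {N} (λ i → toℕ (scale N a i) ^ e)   ≈⟨ ∑-≈ scaled ⟩
      ∑ {N} (λ i → a ^ e * toℕ i ^ e)       ≡⟨ Sum.*-distribˡ-sum {N} (a ^ e) (λ i → toℕ i ^ e) ⟨
      a ^ e * S                             ∎

nonzeroPart : ℕ → ℕ
nonzeroPart zero    = 1
nonzeroPart (suc r) = suc r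

nonzeroPart-≢0 : ∀ r → r ≢ 0 → nonzeroPart r ≡ r
nonzeroPart-≢0 zero    r≢0 = contradiction refl r≢0
nonzeroPart-≢0 (suc r) _   = refl

module PrimeModulus {p′ : ℕ} (pp : Prime (suc p′)) where

  p : ℕ
  p = suc p′

  open Mod p
  open ≈-Reasoning

  -- Fermat's little theorem.  Multiplication by x permutes the non-zero residues
  -- 1, …, p - 1, so their product W satisfies W ≡ x^(p-1)·W, while p ∤ W.
  fermat : ∀ {x} → ¬ p ∣ x → x ^ p′ ≈ 1
  fermat {x} p∤x = ∣∸1⇒≈1 (m^n>0 x p′) p∣x^p′∸1
    where
    instance
      x≢0 : NonZero x
      x≢0 = ≢-nonZero λ { refl → p∤x (divides 0 refl) }

    W : ℕ
    W = ∏ {p′} (λ j → suc (toℕ j))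

    inverse : ∃ λ v → x * v ≈ 1
    inverse = modularInverse {x} {p} (Coprimality.sym (prime⇒coprime-¬∣ pp p∤x))

    π : Fin p → Fin p
    π = scale p x

    π-nonzero : ∀ j → nonzeroPart (toℕ (π (suc j))) ≈ x * suc (toℕ j)
    π-nonzero j = begin
      nonzeroPart (toℕ (π (suc j)))  ≡⟨ nonzeroPart-≢0 _ r≢0 ⟩
      toℕ (π (suc j))                ≡⟨ toℕ-scale p x (suc j) ⟩
      (x * suc (toℕ j)) % p          ≈⟨ %-≈ (x * suc (toℕ j)) ⟩
      x * suc (toℕ j)                ∎
      where
      r≢0 : toℕ (π (suc j)) ≢ 0
      r≢0 r≡0 = ¬∣-* pp p∤x (¬∣-small (s≤s z≤n) (s≤s (toℕ<n j)))
                  (m%n≡0⇒n∣m _ p (trans (sym (toℕ-scale p x (suc j))) r≡0))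

    permuted : ∏ {p} (λ i → nonzeroPart (toℕ (π i))) ≈ x ^ p′ * W
    permuted = begin
      nonzeroPart (toℕ (π zero)) * ∏ {p′} (λ j → nonzeroPart (toℕ (π (suc j))))
        ≡⟨ cong (λ t → nonzeroPart t * ∏ {p′} (λ j → nonzeroPart (toℕ (π (suc j))))) π0≡0 ⟩
      1 * ∏ {p′} (λ j → nonzeroPart (toℕ (π (suc j))))
        ≡⟨ *-identityˡ (∏ {p′} (λ j → nonzeroPart (toℕ (π (suc j))))) ⟩
      ∏ {p′} (λ j → nonzeroPart (toℕ (π (suc j))))
        ≈⟨ ∏-≈ π-nonzero ⟩
      ∏ {p′} (λ j → x * suc (toℕ j))
        ≡⟨ ∏-scale {p′} x (λ j → suc (toℕ j)) ⟩
      x ^ p′ * W  ∎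
      where
      π0≡0 : toℕ (π zero) ≡ 0
      π0≡0 = trans (toℕ-scale p x zero) (cong (_% p) (*-zeroʳ x))

    W≈x^p′W : W ≈ x ^ p′ * W
    W≈x^p′W = ≈-trans (≈-reflexive (trans W≡∏ ∏≡∏∘π)) permuted
      where
      W≡∏ : W ≡ ∏ {p} (λ i → nonzeroPart (toℕ i))
      W≡∏ = sym (*-identityˡ W)
      ∏≡∏∘π : ∏ {p} (λ i → nonzeroPart (toℕ i)) ≡ ∏ {p} (λ i → nonzeroPart (toℕ (π i)))
      ∏≡∏∘π = Product.sum-permute {p} {p} (λ i → nonzeroPart (toℕ i))
                (unitPermutation p x (proj₁ inverse) (proj₂ inverse))

    p∤W : ¬ p ∣ W
    p∤W = ∏-¬∣ {p′} pp (λ j → suc (toℕ j)) (λ j → ¬∣-small (s≤s z≤n) (s≤s (toℕ<n j)))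

    p∣x^p′∸1 : p ∣ x ^ p′ ∸ 1
    p∣x^p′∸1 = coprime-divisor (prime⇒coprime-¬∣ pp p∤W)
                 (subst (p ∣_) (*-comm (x ^ p′ ∸ 1) W) (fixed⇒∣ (x ^ p′) W (m^n>0 x p′) (≈-sym W≈x^p′W)))

  -- p ∣ Σ_{i<p} i^j whenever j + 1 < p.  By strong induction on j: in the recurrence
  -- for exponent j + 1, every term other than C(j+1,1)·Σ_{i<p} i^j is a multiple of p.
  powerSum-vanishes : ∀ j → suc j < p → p ∣ powerSum p j
  powerSum-vanishes = <-rec (λ j → suc j < p → p ∣ powerSum p j) step
    where
    step : ∀ j → (∀ {i} → i < j → suc i < p → p ∣ powerSum p i) → suc j < p → p ∣ powerSum p j
    step j rec j+1<p = coprime-divisor (prime⇒coprime-¬∣ pp (¬∣-small (s≤s z≤n) j+1<p)) p∣[j+1]S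
      where
      linear lower : ℕ
      linear = (suc j C 1) * powerSum p j
      lower  = ∑ {j} (λ k → (suc j C suc (suc (toℕ k))) * powerSum p (j ∸ suc (toℕ k)))
      p∣lower : p ∣ lower
      p∣lower = ∑-∣ {j} (λ k → (suc j C suc (suc (toℕ k))) * powerSum p (j ∸ suc (toℕ k)))
        (λ k → ∣n⇒∣m*n (suc j C suc (suc (toℕ k))) (rec (∸suc< k) (<-trans (s≤s (∸suc< k)) j+1<p)))
      -- the recurrence, with its terms k = 0 (that is, 1·S_{j+1}) and k = 1 unfolded
      recurrence : powerSum p (suc j) + p ^ suc j ≡ (powerSum p (suc j) + 0) + (linear + lower)
      recurrence = powerSum-recurrence p j
      p^[j+1]≡ : p ^ suc j ≡ lower + linear
      p^[j+1]≡ = trans (+-cancelˡ-≡ (powerSum p (suc j)) (p ^ suc j) (linear + lower)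
                         (trans recurrence (cong (_+ (linear + lower)) (+-identityʳ (powerSum p (suc j))))))
                       (+-comm linear lower)
      p∣[j+1]S : p ∣ suc j * powerSum p j
      p∣[j+1]S = subst (λ c → p ∣ c * powerSum p j) (nC1≡n (suc j))
                   (∣m+n∣m⇒∣n (subst (p ∣_) p^[j+1]≡ (m∣m*n (p ^ j))) p∣lower)

  -- p - 1 ≠ 0, so exponents can be reduced modulo p - 1.
  instance
    p′≢0 : NonZero p′
    p′≢0 = >-nonZero (s≤s⁻¹ (prime>1 pp))

  fermat-reduce : ∀ {x} k → ¬ p ∣ x → x ^ k ≈ x ^ (k % p′)
  fermat-reduce {x} k p∤x = begin
    x ^ k                                 ≡⟨ cong (x ^_) (m≡m%n+[m/n]*n k p′) ⟩
    x ^ (k % p′ + k / p′ * p′)            ≡⟨ ^-distribˡ-+-* x (k % p′) (k / p′ * p′) ⟩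
    x ^ (k % p′) * x ^ (k / p′ * p′)      ≡⟨ cong (x ^ (k % p′) *_) x^[qp′]≡ ⟩
    x ^ (k % p′) * (x ^ p′) ^ (k / p′)    ≈⟨ ≈-* (≈-refl {x ^ (k % p′)}) (≈-^ (k / p′) (fermat p∤x)) ⟩
    x ^ (k % p′) * 1 ^ (k / p′)           ≡⟨ cong (x ^ (k % p′) *_) (^-zeroˡ (k / p′)) ⟩
    x ^ (k % p′) * 1                      ≡⟨ *-identityʳ (x ^ (k % p′)) ⟩
    x ^ (k % p′)                          ∎
    where
    x^[qp′]≡ : x ^ (k / p′ * p′) ≡ (x ^ p′) ^ (k / p′)
    x^[qp′]≡ = trans (cong (x ^_) (*-comm (k / p′) p′)) (sym (^-*-assoc x p′ (k / p′)))

  -- If every non-zero residue is a k-th root of unity, then (p - 1) ∣ k: otherwise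
  -- d = k mod (p - 1) satisfies 0 < d < p - 1, and Σ_{i<p} i^d would be both ≡ 0
  -- (powerSum-vanishes) and ≡ p - 1 (each non-zero term is ≡ 1 by fermat-reduce).
  allRoots⇒∣ : ∀ k → (∀ g → 0 < g → g < p → g ^ k ≈ 1) → p′ ∣ k
  allRoots⇒∣ k roots with k % p′ in d≡
  ... | zero  = m%n≡0⇒n∣m k p′ d≡
  ... | suc d = contradiction (≈0⇒∣ (≈-trans (≈-sym S≈p′) S≈0)) (¬∣-small (>-nonZero⁻¹ p′) (n<1+n p′))
    where
    indicator : ℕ → ℕ
    indicator zero    = 0
    indicator (suc _) = 1
    term : ∀ (i : Fin p) → toℕ i ^ suc d ≈ indicator (toℕ i)
    term i with toℕ i | toℕ<n i
    ... | zero  | _   = ≈-refl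
    ... | suc x | x<p = begin
      suc x ^ suc d       ≡⟨ cong (suc x ^_) d≡ ⟨
      suc x ^ (k % p′)    ≈⟨ fermat-reduce k (¬∣-small (s≤s z≤n) x<p) ⟨
      suc x ^ k           ≈⟨ roots (suc x) (s≤s z≤n) x<p ⟩
      1                   ∎
    S≈p′ : powerSum p (suc d) ≈ p′
    S≈p′ = ≈-trans (∑-≈ term) (≈-reflexive (∑-ones p′))
    S≈0 : powerSum p (suc d) ≈ 0
    S≈0 = ∣⇒≈0 (powerSum-vanishes (suc d) (s≤s (subst (_< p′) d≡ (m%n<n k p′))))

  nonRoot : ∀ k → ¬ p′ ∣ k → ∃ λ g → ¬ p ∣ g × ¬ g ^ k ≈ 1
  nonRoot k p′∤k with anyUpTo? (λ g → 0 <? g ×-dec ¬? (g ^ k % p ≟ 1 % p)) p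
  ... | yes (g , g<p , 0<g , g^k≢1) = g , ¬∣-small 0<g g<p , g^k≢1 ∘ ≈⇒%≡
  ... | no noWitness = contradiction (allRoots⇒∣ k roots) p′∤k
    where
    roots : ∀ g → 0 < g → g < p → g ^ k ≈ 1
    roots g 0<g g<p = %≡⇒≈ (decidable-stable (g ^ k % p ≟ 1 % p)
                               (λ g^k≢1 → noWitness (g , g<p , 0<g , g^k≢1)))

-- If n = q^r·m and d divides both q - 1 and n - 1, then d divides m - 1:
-- modulo d we have q ≡ 1, hence m ≡ q^r·m = n ≡ 1.
cofactor-∣∸1 : ∀ d .{{_ : NonZero d}} {q r m n} → 1 ≤ q → 1 ≤ n → n ≡ q ^ r * m →
               d ∣ q ∸ 1 → d ∣ n ∸ 1 → d ∣ m ∸ 1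
cofactor-∣∸1 d {q} {r} {m} {n} 1≤q 1≤n n≡ d∣q∸1 d∣n∸1 = ≈⇒∣∸ 1≤m (begin
  m           ≡⟨ *-identityˡ m ⟨
  1 * m       ≡⟨ cong (_* m) (^-zeroˡ r) ⟨
  1 ^ r * m   ≈⟨ ≈-* (≈-^ r (∣∸1⇒≈1 1≤q d∣q∸1)) (≈-refl {m}) ⟨
  q ^ r * m   ≡⟨ n≡ ⟨
  n           ≈⟨ ∣∸1⇒≈1 1≤n d∣n∸1 ⟩
  1           ∎)
  where
  open Mod d
  open ≈-Reasoning
  1≤m : 1 ≤ m
  1≤m = n≢0⇒n>0 λ { refl → <⇒≢ 1≤n (sym (trans n≡ (*-zeroʳ (q ^ r)))) }

-- For n = 2e + 1 = q^r·m, the hypothesis (q - 1) ∤ (m - 1) gives (q - 1) ∤ e,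
-- since (q - 1) ∣ e would give (q - 1) ∣ 2e = n - 1.
q∸1∤e : ∀ e q r m → 1 < q → suc (2 * e) ≡ q ^ r * m → ¬ (q ∸ 1) ∣ (m ∸ 1) → ¬ (q ∸ 1) ∣ e
q∸1∤e e 1 r m (s≤s ()) _ _ _
q∸1∤e e q@(suc q′@(suc _)) r m _ n≡ q′∤m∸1 q′∣e =
  q′∤m∸1 (cofactor-∣∸1 q′ {q} {r} {m} (s≤s z≤n) (s≤s z≤n) n≡ ∣-refl (∣n⇒∣m*n 2 q′∣e))

-- A unit g modulo the prime q lifts to a unit a modulo n = q^r·m (q ∤ m) with
-- a ≡ g (mod q): take a = 1 + m·u·(g - 1), where m·u ≡ 1 (mod q).  Then a ≡ 1
-- (mod m) and a ≡ g (mod q), so a is coprime to both m and q^r.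
liftUnit : ∀ {q r m n g} .{{_ : NonZero q}} → Prime q → n ≡ q ^ r * m → ¬ q ∣ m → ¬ q ∣ g →
           ∃ λ a′ → Mod._≈_ q (suc a′) g × Coprime (suc a′) n
liftUnit {q} {r} {m} {n} {g} pq n≡ q∤m q∤g = a′ , a≈g , a⊥n
  where
  open Mod q
  open ≈-Reasoning
  inverse : ∃ λ u → m * u ≈ 1
  inverse = modularInverse {m} {q} (Coprimality.sym (prime⇒coprime-¬∣ pq q∤m))
  u a′ : ℕ
  u  = proj₁ inverse
  a′ = m * (u * (g ∸ 1))
  1≤g : 1 ≤ g
  1≤g = n≢0⇒n>0 λ { refl → q∤g (divides 0 refl) }
  a≈g : suc a′ ≈ g
  a≈g = begin
    1 + m * (u * (g ∸ 1))   ≡⟨ cong (1 +_) (*-assoc m u (g ∸ 1)) ⟨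
    1 + m * u * (g ∸ 1)     ≈⟨ ≈-+ (≈-refl {1}) (≈-* (proj₂ inverse) (≈-refl {g ∸ 1})) ⟩
    1 + 1 * (g ∸ 1)         ≡⟨ cong (1 +_) (*-identityˡ (g ∸ 1)) ⟩
    1 + (g ∸ 1)             ≡⟨ m+[n∸m]≡n 1≤g ⟩
    g                       ∎
  q∤a : ¬ q ∣ suc a′
  q∤a q∣a = q∤g (≈0⇒∣ (≈-trans (≈-sym a≈g) (∣⇒≈0 q∣a)))
  a⊥m : Coprime (suc a′) m
  a⊥m {i} (i∣a , i∣m) = ∣1⇒≡1 (∣m+n∣m⇒∣n (subst (i ∣_) (+-comm 1 a′) i∣a) (∣m⇒∣m*n (u * (g ∸ 1)) i∣m))
  a⊥n : Coprime (suc a′) n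
  a⊥n = subst (Coprime _) (sym n≡)
          (Coprimality.sym (coprime-* (coprime-^ r (prime⇒coprime-¬∣ pq q∤a)) (Coprimality.sym a⊥m)))

-- Some unit g is not an e-th root of unity modulo q;
-- lifting it to a unit a modulo n gives n ∣ (a^e - 1)·Σ_{i<n} i^e, and q ∤ a^e - 1.
primePower-∣-powerSum : ∀ e q r m → Prime q → suc (2 * e) ≡ q ^ r * m → ¬ q ∣ m →
                        ¬ (q ∸ 1) ∣ (m ∸ 1) → q ^ r ∣ powerSum (suc (2 * e)) e
primePower-∣-powerSum e q@(suc _) r m pq n≡ q∤m q∸1∤m∸1
  with PrimeModulus.nonRoot pq e (q∸1∤e e q r m (prime>1 pq) n≡ q∸1∤m∸1)
... | g , q∤g , g^e≉1 with liftUnit {r = r} pq n≡ q∤m q∤g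
...   | a′ , a≈g , a⊥n = primePower-cancel r pq q∤a^e∸1 (∣-trans q^r∣n n∣[a^e∸1]S)
  where
  n a : ℕ
  n = suc (2 * e)
  a = suc a′
  q^r∣n : q ^ r ∣ n
  q^r∣n = divides m (trans n≡ (*-comm (q ^ r) m))
  inverse : ∃ λ b → Mod._≈_ n (a * b) 1
  inverse = modularInverse {a} {n} a⊥n
  n∣[a^e∸1]S : n ∣ (a ^ e ∸ 1) * powerSum n e
  n∣[a^e∸1]S = powerSum-unit n a (proj₁ inverse) (proj₂ inverse) e
  q∤a^e∸1 : ¬ q ∣ a ^ e ∸ 1
  q∤a^e∸1 q∣ = g^e≉1 (Mod.≈-trans q (Mod.≈-sym q (Mod.≈-^ q e a≈g)) (Mod.∣∸1⇒≈1 q (m^n>0 a e) q∣))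

primeFactor : ∀ N → 1 < N → ∃ λ p → Prime p × p ∣ N
primeFactor 1 (s≤s ())
primeFactor N@(suc (suc _)) _ with factorise N
... | record { factors = [] ; isFactorisation = () }
... | record { factors = p ∷ ps ; isFactorisation = N≡ ; factorsPrime = pp ∷ _ } =
  p , pp , divides (product ps) (trans N≡ (*-comm p (product ps)))

-- By strong induction on N: split N = p^s·M with p a prime factor and p ∤ M; then
-- p^s ∣ T by assumption, M ∣ T by induction, and p^s and M are coprime.
primePowers-∣ : ∀ T N .{{_ : NonZero N}} → (∀ q s → Prime q → q ^ s ∣ N → q ^ s ∣ T) → N ∣ T
primePowers-∣ T = <-rec (λ N → .{{_ : NonZero N}} → Local N → N ∣ T) step
  where
  Local : ℕ → Set
  Local N = ∀ q s → Prime q → q ^ s ∣ N → q ^ s ∣ T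
  step : ∀ N → (∀ {M} → M < N → .{{_ : NonZero M}} → Local M → M ∣ T) →
         .{{_ : NonZero N}} → Local N → N ∣ T
  step 1 _ _ = 1∣ T
  step N@(suc (suc _)) rec local with primeFactor N (s≤s (s≤s z≤n))
  ... | p , pp , p∣N with exactPower p (prime>1 pp) N
  ...   | zero , M , N≡ , p∤M = contradiction (subst (p ∣_) (trans N≡ (*-identityˡ M)) p∣N) p∤M
  ...   | suc s , M , N≡ , p∤M =
    subst (_∣ T) (sym N≡) (coprime-∣-* (coprime-^ (suc s) (prime⇒coprime-¬∣ pp p∤M)) p^s∣T M∣T)
    where
    instance
      M≢0 : NonZero M
      M≢0 = ≢-nonZero λ { refl → 0≢1+n (sym (trans N≡ (*-zeroʳ (p ^ suc s)))) }
    p^s∣T : p ^ suc s ∣ T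
    p^s∣T = local p (suc s) pp (divides M (trans N≡ (*-comm (p ^ suc s) M)))
    M<N : M < N
    M<N = subst (M <_) (sym (trans N≡ (*-comm (p ^ suc s) M)))
                (m<m*n M (p ^ suc s) (^-monoʳ-< p (prime>1 pp) {0} {suc s} (s≤s z≤n)))
    M∣T : M ∣ T
    M∣T = rec M<N (λ q t pq q^t∣M → local q t pq (∣-trans q^t∣M (divides (p ^ suc s) N≡)))

sum-applyUpTo : ∀ m (f g : ℕ → ℕ) → sum (map g (applyUpTo f m)) ≡ ∑ {m} (λ i → g (f (toℕ i)))
sum-applyUpTo zero    f g = refl
sum-applyUpTo (suc m) f g = cong (g (f 0) +_) (sum-applyUpTo m (f ∘ suc) g)

-- For n = 2e + 1 with e ≥ 1, G(n) is the power sum Σ_{i<n} i^e (the term 0^e vanishes).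
G≡powerSum : ∀ e → .{{NonZero e}} → G (suc (2 * e)) ≡ powerSum (suc (2 * e)) e
G≡powerSum e@(suc _) = begin
  G (suc (2 * e))                             ≡⟨ cong (λ t → sum (map (λ j → suc j ^ t) (upTo (2 * e)))) [2e]/2≡e ⟩
  sum (map (λ j → suc j ^ e) (upTo (2 * e)))  ≡⟨ sum-applyUpTo (2 * e) id (λ j → suc j ^ e) ⟩
  powerSum (suc (2 * e)) e                    ∎
  where
  open ≡-Reasoning
  [2e]/2≡e : 2 * e / 2 ≡ e
  [2e]/2≡e = trans (cong (_/ 2) (*-comm 2 e)) (m*n/n≡m e 2)

-- For n = 1 there is nothing to prove; otherwise G(n) is the power
-- sum, and every prime power q^s ∣ n divides it: q^s divides the exact power q^r of
-- q in n, which divides the power sum by the local step.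
mainTheorem8 : (n : ℕ) → Odd n →
    ((p r m : ℕ) → Prime p → p ∣ n → n ≡ p ^ r * m → ¬ (p ∣ m) →
    ¬ ((p ∸ 1) ∣ (m ∸ 1))) →
    InP n
mainTheorem8 .1 odd@(zero , refl) _ = odd , 1∣ G 1
mainTheorem8 n odd@(e@(suc _) , refl) hyp =
  odd , subst (n ∣_) (sym (G≡powerSum e)) (primePowers-∣ (powerSum n e) n local)
  where
  local : ∀ q s → Prime q → q ^ s ∣ n → q ^ s ∣ powerSum n e
  local q zero    _  _      = 1∣ powerSum n e
  local q (suc s) pq q^s∣n with exactPower q (prime>1 pq) n
  ... | r , m , n≡ , q∤m = ∣-trans q^s∣q^r
          (primePower-∣-powerSum e q r m pq n≡ q∤m (hyp q r m pq q∣n n≡ q∤m))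
    where
    q∣n : q ∣ n
    q∣n = ∣-trans (m∣m*n (q ^ s)) q^s∣n
    q^s∣q^r : q ^ suc s ∣ q ^ r
    q^s∣q^r = primePower-cancel (suc s) pq q∤m (subst (q ^ suc s ∣_) (trans n≡ (*-comm (q ^ r) m)) q^s∣n)
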